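{- Let $G$ be a finite simple graph, $v_0 \in V(G)$, and $P$ a longest $v_0$-path in $G$. Let $x \in L(G,P,v_0)$ satisfy $c(x) = \min\{c(v) \mid v \in L(G,P,v_0)\}$. Then for every $v \in L(G,P,v_0)$, every path in $\mathcal{T}_v$ is good, i.e. for every $P_v \in \mathcal{T}_v$ the terminal vertex $v$ is not adjacent to any vertex of $P_v$ whose distance from $v$ along $P_v$ is at least $c(x)$.
   Context: For $v\in V(G)$, $c(v)$ is the length of the longest cycle containing $v$, or $2$ if $v$ is on no cycle. A $v_0$-path is a path starting at $v_0$; its other end is its terminal vertex; a longest $v_0$-path is one of maximum length among $v_0$-paths. If $Q = v_0v_1\dots v_k$ is a longest $v_0$-path and $v_k$ is adjacent to $v_j$ for some $0 \le j \le k-2$, the path $v_0v_1\dots v_jv_kv_{k-1}\dots v_{j+1}$ is a simple transform of $Q$. A transform of $P$ is any path obtained from $P$ by a finite sequence of simple transforms; $\mathcal{T}$ is the set of all transforms of $P$ (all are longest $v_0$-paths on vertex set $V(P)$). $L(G,P,v_0)$ is the set of terminal vertices of paths in $\mathcal{T}$, and for $v \in L(G,P,v_0)$, $\mathcal{T}_v$ is the set of paths in $\mathcal{T}$ with terminal vertex $v$. Distance along a path means the number of path edges between the two vertices. -}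

module Defs where

open import Data.Nat using (ℕ; _≤_; _∸_)
open import Data.Fin using (Fin)
open import Data.List using (List; []; _∷_; _++_; length; reverse)
open import Data.List.Membership.Propositional using (_∈_)
open import Data.List.Relation.Unary.Unique.Propositional using (Unique)
open import Data.List.Relation.Unary.Linked using (Linked)
open import Data.Product using (Σ; ∃; ∃-syntax; _×_)
open import Data.Sum using (_⊎_)
open import Relation.Nullary using (¬_; Dec)
open import Relation.Binary.PropositionalEquality using (_≡_)
open import Relation.Binary.Construct.Closure.ReflexiveTransitive using (Star)

record SimpleGraph (n : ℕ) : Set₁ where
  field
    Adj    : Fin n → Fin n → Set
    adj?   : ∀ u v → Dec (Adj u v)
    sym    : ∀ {u v} → Adj u v → Adj v u
    irrefl : ∀ {u} → ¬ Adj u u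

module _ {n : ℕ} (G : SimpleGraph n) where
  open SimpleGraph G

  V : Set
  V = Fin n

  IsPath : List V → Set
  IsPath Q = Unique Q × Linked Adj Q

  IsV0Path : V → List V → Set
  IsV0Path v0 Q = IsPath Q × ∃[ rest ] (Q ≡ v0 ∷ rest)

  pathLength : List V → ℕ
  pathLength Q = length Q ∸ 1

  IsLongestV0Path : V → List V → Set
  IsLongestV0Path v0 Q =
    IsV0Path v0 Q × (∀ Q' → IsV0Path v0 Q' → pathLength Q' ≤ pathLength Q)

  Terminal : List V → V → Set
  Terminal Q v = ∃[ A ] (Q ≡ A ++ v ∷ [])

  -- A cycle u ∷ D ++ [w] with at least 3 vertices, distinct, consecutive
  -- adjacent and w adjacent to u; its length is its number of vertices.
  IsCycle : List V → Set
  IsCycle C = IsPath C × (∃[ u ] ∃[ D ] ∃[ w ]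
      (C ≡ u ∷ D ++ w ∷ [] × 1 ≤ length D × Adj w u))

  IsC : V → ℕ → Set
  IsC v m =
    (∃[ C ] (IsCycle C × v ∈ C × length C ≡ m
        × (∀ C' → IsCycle C' → v ∈ C' → length C' ≤ m)))
    ⊎ (m ≡ 2 × (∀ C → IsCycle C → ¬ (v ∈ C)))

  -- Simple transform of a longest v0-path Q = v0 … vj v(j+1) … vk with
  -- vk adjacent to vj, j ≤ k-2 (so at least one vertex b = v(j+1) lies
  -- strictly between vj and vk):  Q' = v0 … vj vk v(k-1) … v(j+1).
  SimpleTransform : V → List V → List V → Set
  SimpleTransform v0 Q Q' = IsLongestV0Path v0 Q ×
    (∃[ A ] ∃[ vj ] ∃[ b ] ∃[ B ] ∃[ vk ]
      (Q ≡ A ++ vj ∷ b ∷ (B ++ vk ∷ [])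
       × Adj vk vj
       × Q' ≡ A ++ vj ∷ vk ∷ reverse (b ∷ B)))

  Transform : V → List V → List V → Set
  Transform v0 = Star (SimpleTransform v0)

  InL : V → List V → V → Set
  InL v0 P v = ∃[ Q ] (Transform v0 P Q × Terminal Q v)

  InT : V → List V → V → List V → Set
  InT v0 P v Q = Transform v0 P Q × Terminal Q v

  -- Q (with terminal v) is good w.r.t. bound k: v is not adjacent to any
  -- vertex u of Q whose distance from v along Q (= length B, where
  -- Q = A ++ u ∷ B) is at least k.
  Good : ℕ → List V → V → Set
  Good k Q v = ∀ A u B → Q ≡ A ++ u ∷ B → k ≤ length B → ¬ Adj v u

{-# OPTIONS --safe #-}
-- Say that a path Q has a k-cycle tail if some final segment of Q with
-- more than k vertices lies on a cycle with more than k vertices.  A simple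
-- transform A vj T ⟶ A vj T′ reverses the tail T, and both vj T and vj T′
-- are cycles (closed by the edges vj vk and vj v(j+1)); so a k-cycle tail
-- either contains vj T, and is merely permuted, or lies inside vj T, and
-- is then replaced by the cycle vj T′.  Hence having a k-cycle tail passes
-- along transforms in both directions, and so between any two paths of 𝒯.
-- If P_v ∈ 𝒯_v had v adjacent to a vertex u at distance ≥ c(x), the
-- segment from u to v would close up to a c(x)-cycle tail; then any path
-- of 𝒯_x has one too, putting x on a cycle longer than c(x).
module Submission where

open import Defs
open import Data.Nat using (ℕ; _≤_; _<_; s≤s; z≤n)
open import Data.Nat.Properties using (≤-refl; ≤-trans; <-irrefl; module ≤-Reasoning)
open import Data.Fin using (Fin)
open import Data.List using (List; []; _∷_; _++_; [_]; _∷ʳ_; length; reverse; _ʳ++_)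
open import Data.List.Properties
  using (∷-injective; ∷-injectiveʳ; ++-assoc; reverse-++; unfold-reverse; length-++-≤ʳ)
open import Data.List.Membership.Propositional using (_∈_)
open import Data.List.Membership.Propositional.Properties using (∈-++⁺ʳ)
open import Data.List.Relation.Binary.Subset.Propositional using (_⊆_)
open import Data.List.Relation.Binary.Permutation.Propositional
  using (_↭_; prep; ↭-sym; ↭⇒↭ₛ)
open import Data.List.Relation.Binary.Permutation.Propositional.Properties
  using (∈-resp-↭; ↭-length; ++⁺ˡ; ↭-reverse)
import Data.List.Relation.Binary.Permutation.Setoid.Properties as Permutationₛ
open import Data.List.Relation.Unary.Any using (here)
open import Data.List.Relation.Unary.AllPairs using (_∷_)
open import Data.List.Relation.Unary.Unique.Propositional using (Unique)
open import Data.List.Relation.Unary.Linked as Linked using (Linked; [-]; _∷_)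
open import Data.Product using (∃-syntax; _×_; _,_)
open import Data.Sum using (_⊎_; inj₁; inj₂)
open import Function using (_∘_; id)
open import Level using (Level)
open import Relation.Binary.Core using (Rel)
open import Relation.Binary.Definitions using (Symmetric; _Respects_)
open import Relation.Binary.PropositionalEquality
  using (_≡_; refl; sym; trans; cong; subst; setoid)
open import Relation.Binary.Construct.Closure.ReflexiveTransitive as Star
  using (Star; ε; _◅_; _◅◅_)
open import Relation.Unary using (Pred)

private
  variable
    a ℓ p : Level
    A : Set a

++-equidivisible : ∀ (X R Y S : List A) → X ++ R ≡ Y ++ S →
  (∃[ Z ] (X ≡ Y ++ Z × S ≡ Z ++ R)) ⊎ (∃[ Z ] (Y ≡ X ++ Z × R ≡ Z ++ S))
++-equidivisible []      R Y       S eq = inj₂ (Y , refl , eq)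
++-equidivisible (x ∷ X) R []      S eq = inj₁ (x ∷ X , refl , sym eq)
++-equidivisible (x ∷ X) R (y ∷ Y) S eq with ∷-injective eq
... | refl , eq′ with ++-equidivisible X R Y S eq′
...   | inj₁ (Z , X≡Y++Z , S≡Z++R) = inj₁ (Z , cong (x ∷_) X≡Y++Z , S≡Z++R)
...   | inj₂ (Z , Y≡X++Z , R≡Z++S) = inj₂ (Z , cong (x ∷_) Y≡X++Z , R≡Z++S)

∷ʳ-suffix : ∀ (X : List A) {s S} Y {x} → X ++ s ∷ S ≡ Y ∷ʳ x → ∃[ S′ ] (s ∷ S ≡ S′ ∷ʳ x)
∷ʳ-suffix []          Y       eq = Y , eq
∷ʳ-suffix (_ ∷ X)     (_ ∷ Y) eq = ∷ʳ-suffix X Y (∷-injectiveʳ eq)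
∷ʳ-suffix (_ ∷ [])    []      ()
∷ʳ-suffix (_ ∷ _ ∷ _) []      ()

Unique-resp-↭ : Unique {A = A} Respects _↭_
Unique-resp-↭ = Permutationₛ.Unique-resp-↭ (setoid _) ∘ ↭⇒↭ₛ

module _ {R : Rel A ℓ} where

  Linked-++⁻ʳ : ∀ X {S} → Linked R (X ++ S) → Linked R S
  Linked-++⁻ʳ []      linked = linked
  Linked-++⁻ʳ (_ ∷ X) linked = Linked-++⁻ʳ X (Linked.tail linked)

  Linked-replaceTail : ∀ X {y T T′} → Linked R (X ++ y ∷ T) → Linked R (y ∷ T′) → Linked R (X ++ y ∷ T′)
  Linked-replaceTail []          _      linked′ = linked′
  Linked-replaceTail (_ ∷ [])    linked linked′ = Linked.head linked ∷ linked′
  Linked-replaceTail (_ ∷ x ∷ X) linked linked′ =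
    Linked.head linked ∷ Linked-replaceTail (x ∷ X) (Linked.tail linked) linked′

  module _ (R-sym : Symmetric R) where

    Linked-ʳ++ : ∀ {x} xs {acc} → Linked R (x ∷ xs) → Linked R (x ∷ acc) → Linked R (xs ʳ++ x ∷ acc)
    Linked-ʳ++ []      _            linked′ = linked′
    Linked-ʳ++ (_ ∷ xs) (Rxy ∷ linked) linked′ = Linked-ʳ++ xs linked (R-sym Rxy ∷ linked′)

    Linked-reverse : ∀ {xs} → Linked R xs → Linked R (reverse xs)
    Linked-reverse {[]}     linked = linked
    Linked-reverse {_ ∷ xs} linked = Linked-ʳ++ xs linked [-]

Star-resp : {R : Rel A ℓ} {P : Pred A p} → P Respects R → P Respects Star R
Star-resp resp ε        = id
Star-resp resp (r ◅ rs) = Star-resp resp rs ∘ resp r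

module _ {n : ℕ} (G : SimpleGraph n) where
  open SimpleGraph G renaming (sym to Adj-sym)

  private
    variable
      k m : ℕ
      u v w x v0 : Fin n
      B C Q Q′ : List (Fin n)

  IsPath-++⁻ʳ : ∀ X {S} → IsPath G (X ++ S) → IsPath G S
  IsPath-++⁻ʳ []      path                = path
  IsPath-++⁻ʳ (_ ∷ X) (_ ∷ uniq , linked) = IsPath-++⁻ʳ X (uniq , Linked.tail linked)

  closeCycle : IsPath G (u ∷ v ∷ B ∷ʳ w) → Adj w u → IsCycle G (u ∷ v ∷ B ∷ʳ w)
  closeCycle path w~u = path , _ , _ ∷ _ , _ , refl , s≤s z≤n , w~u

  cycle-reverse : ∀ {T} → IsCycle G (u ∷ T) → IsCycle G (u ∷ reverse T)
  cycle-reverse {u} ((uniq , linked) , _ , v ∷ B , w , refl , _ , w~u) =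
    subst (λ T′ → IsCycle G (u ∷ T′)) (sym reverse-T)
      (closeCycle (uniq′ , linked′) (Adj-sym (Linked.head linked)))
    where
    T = v ∷ B ∷ʳ w
    reverse-T : reverse T ≡ w ∷ reverse B ∷ʳ v
    reverse-T = trans (reverse-++ (v ∷ B) [ w ]) (cong (w ∷_) (unfold-reverse v B))
    uniq′ : Unique (u ∷ w ∷ reverse B ∷ʳ v)
    uniq′ = subst (Unique ∘ (u ∷_)) reverse-T
      (Unique-resp-↭ (prep u (↭-sym (↭-reverse T))) uniq)
    linked′ : Linked Adj (u ∷ w ∷ reverse B ∷ʳ v)
    linked′ = Adj-sym w~u ∷ subst (Linked Adj) reverse-T (Linked-reverse Adj-sym (Linked.tail linked))

  2≤cycle-length : IsCycle G C → 2 ≤ length C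
  2≤cycle-length (_ , _ , []    , _ , _    , ()      , _)
  2≤cycle-length (_ , _ , _ ∷ _ , _ , refl , s≤s z≤n , _) = s≤s (s≤s z≤n)

  2≤c : IsC G v m → 2 ≤ m
  2≤c (inj₁ (_ , C-cycle , _ , refl , _)) = 2≤cycle-length C-cycle
  2≤c (inj₂ (refl , _))                   = ≤-refl

  cycle-length≤c : IsC G v m → IsCycle G C → v ∈ C → length C ≤ m
  cycle-length≤c (inj₁ (_ , _ , _ , _ , longest)) C-cycle v∈C = longest _ C-cycle v∈C
  cycle-length≤c (inj₂ (_ , acyclic))             C-cycle v∈C with () ← acyclic _ C-cycle v∈C

  -- Simple transforms and their inverses are rotations with T′ = reverse T.
  data Rotation : List (Fin n) → List (Fin n) → Set where
    rotation : ∀ X y {T T′} → T ↭ T′ → IsCycle G (y ∷ T) → IsCycle G (y ∷ T′) →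
               Rotation (X ++ y ∷ T) (X ++ y ∷ T′)

  rotation-sym : Rotation Q Q′ → Rotation Q′ Q
  rotation-sym (rotation X y T↭T′ cycle cycle′) = rotation X y (↭-sym T↭T′) cycle′ cycle

  simpleTransform⇒rotation : SimpleTransform G v0 Q Q′ → Rotation Q Q′
  simpleTransform⇒rotation (((Q-path , _) , _) , A , vj , b , B , vk , refl , vk~vj , refl) =
    subst (Rotation (A ++ vj ∷ T)) (cong (λ T′ → A ++ vj ∷ T′) (reverse-++ (b ∷ B) [ vk ]))
      (rotation A vj (↭-sym (↭-reverse T)) cycle (cycle-reverse cycle))
    where
    T = b ∷ B ∷ʳ vk
    cycle : IsCycle G (vj ∷ T)
    cycle = closeCycle (IsPath-++⁻ʳ A Q-path) vk~vj

  transform⇒rotations : Transform G v0 Q Q′ → Star Rotation Q Q′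
  transform⇒rotations = Star.map simpleTransform⇒rotation

  rotation-isPath : IsPath G Respects Rotation
  rotation-isPath (rotation X y T↭T′ _ ((_ , linked′) , _)) (uniq , linked) =
    Unique-resp-↭ (++⁺ˡ X (prep y T↭T′)) uniq , Linked-replaceTail X linked linked′

  data CycleTail (k : ℕ) (Q : List (Fin n)) : Set where
    cycleTail : ∀ X S C → Q ≡ X ++ S → k < length S →
                IsCycle G C → k < length C → S ⊆ C → CycleTail k Q

  rotation-cycleTail : CycleTail k Respects Rotation
  rotation-cycleTail {k} (rotation X y {T} {T′} T↭T′ _ cycle′)
                         (cycleTail Y S C eq k<|S| C-cycle k<|C| S⊆C)
    with ++-equidivisible X (y ∷ T) Y S eq
  ... | inj₁ (Z , refl , refl) =
    cycleTail Y (Z ++ y ∷ T′) C (++-assoc Y Z (y ∷ T′)) (subst (k <_) (↭-length Z↭) k<|S|)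
      C-cycle k<|C| (S⊆C ∘ ∈-resp-↭ (↭-sym Z↭))
    where
    Z↭ : Z ++ y ∷ T ↭ Z ++ y ∷ T′
    Z↭ = ++⁺ˡ Z (prep y T↭T′)
  ... | inj₂ (Z , _ , y∷T≡Z++S) = cycleTail X (y ∷ T′) (y ∷ T′) refl k<|y∷T′| cycle′ k<|y∷T′| id
    where
    open ≤-Reasoning
    k<|y∷T′| : k < length (y ∷ T′)
    k<|y∷T′| = begin-strict
      k                <⟨ k<|S| ⟩
      length S         ≤⟨ length-++-≤ʳ S {Z} ⟩
      length (Z ++ S)  ≡⟨ cong length (sym y∷T≡Z++S) ⟩
      length (y ∷ T)   ≡⟨ ↭-length (prep y T↭T′) ⟩
      length (y ∷ T′)  ∎

  chord⇒cycleTail : ∀ X → IsPath G (X ++ u ∷ B) → Terminal G (X ++ u ∷ B) v →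
    2 ≤ k → k ≤ length B → Adj v u → CycleTail k (X ++ u ∷ B)
  chord⇒cycleTail X path (Y , ends-v) 2≤k k≤|B| v~u with ∷ʳ-suffix X Y ends-v | ≤-trans 2≤k k≤|B|
  ... | []        , refl | ()
  ... | _ ∷ []    , refl | s≤s ()
  ... | _ ∷ _ ∷ _ , refl | _ =
    cycleTail X _ _ refl (s≤s k≤|B|) (closeCycle (IsPath-++⁻ʳ X path) v~u) (s≤s k≤|B|) id

  cycleTail⇒k<c : CycleTail k Q → Terminal G Q x → IsC G x m → k < m
  cycleTail⇒k<c (cycleTail X []      C refl ()    _       _     _)   _
  cycleTail⇒k<c {x = x} (cycleTail X (s ∷ S) C refl k<|S| C-cycle k<|C| S⊆C) (Y , ends-x) c[x]≡m
    with S′ , s∷S≡S′∷ʳx ← ∷ʳ-suffix X Y ends-x =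
    ≤-trans k<|C| (cycle-length≤c c[x]≡m C-cycle (S⊆C x∈s∷S))
    where
    x∈s∷S : x ∈ s ∷ S
    x∈s∷S = subst (x ∈_) (sym s∷S≡S′∷ʳx) (∈-++⁺ʳ S′ (here refl))

lemma2p17 : {n : ℕ} (G : SimpleGraph n) (v0 : Fin n) (P : List (Fin n)) →
    IsLongestV0Path G v0 P →
    (x : Fin n) (cx : ℕ) → InL G v0 P x → IsC G x cx →
    (∀ v m → InL G v0 P v → IsC G v m → cx ≤ m) →
    ∀ v Q → InT G v0 P v Q → Good G cx Q v
lemma2p17 G v0 P ((P-path , _) , _) x cx (Px , P⇝Px , Px-ends-x) c[x]≡cx _ v Q (P⇝Q , Q-ends-v)
          X u B refl cx≤|B| v~u =
  <-irrefl refl (cycleTail⇒k<c G Px-tail Px-ends-x c[x]≡cx)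
  where
  Q-path : IsPath G Q
  Q-path = Star-resp (rotation-isPath G) (transform⇒rotations G P⇝Q) P-path
  Q-tail : CycleTail G cx Q
  Q-tail = chord⇒cycleTail G X Q-path Q-ends-v (2≤c G c[x]≡cx) cx≤|B| v~u
  Q⇝Px : Star (Rotation G) Q Px
  Q⇝Px = Star.reverse (rotation-sym G) (transform⇒rotations G P⇝Q) ◅◅ transform⇒rotations G P⇝Px
  Px-tail : CycleTail G cx Px
  Px-tail = Star-resp (rotation-cycleTail G) Q⇝Px Q-tail
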